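{- Let $L=(L,\leq,(\sqsubseteq_\alpha)_{\alpha<\kappa})$ be a stratified complete lattice. Then $L$ is a model iff $L$ is isomorphic to the stratified complete lattice determined by the limit of an inverse system of complete lattices $L_\alpha$, $\alpha<\kappa$, with locally completely additive projections $h^\alpha_\beta:L_\alpha\to L_\beta$, $\beta<\alpha<\kappa$.
   Context: Fix a limit ordinal $\kappa$. A stratified complete lattice is $(L,\leq,(\sqsubseteq_\alpha)_{\alpha<\kappa})$ where $(L,\leq)$ is a complete lattice and each $\sqsubseteq_\alpha$ is a preorder; $x=_\alpha y$ means $x\sqsubseteq_\alpha y$ and $y\sqsubseteq_\alpha x$. Axioms: (A1) for $\alpha<\beta<\kappa$, $x\sqsubseteq_\beta y$ implies $x=_\alpha y$; (A2) if $x=_\alpha y$ for all $\alpha$ then $x=y$; (A3) for all $x$, $\alpha$ there is $y$ with $x=_\alpha y$ such that $x\sqsubseteq_\alpha z$ implies $y\leq z$ for all $z$ (unique, denoted $x|_\alpha$); (A4) for nonempty $I$ and $x_i=_\alpha y$ ($i\in I$), $\bigvee_i x_i=_\alpha y$; (A5) $x\leq y$ implies $x|_\alpha\leq y|_\alpha$; (A6) if $x\leq y$ and $x=_\beta y$ for all $\beta<\alpha$ then $x\sqsubseteq_\alpha y$. A model satisfies A1–A6. An isomorphism is a bijection preserving and reflecting $\leq$ and every $\sqsubseteq_\alpha$. For complete lattices $L,L'$, a monotone $h:L'\to L$ is a projection if there is monotone $k:L\to L'$ with $h\circ k=\mathrm{id}_L$ and $k(h(y))\leq y$ for all $y$; $h$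 is locally completely additive if for every nonempty $Y\subseteq L'$ with $h(Y)=\{x\}$ one has $h(\bigvee Y)=x$. An inverse system: complete lattices $L_\alpha$ and projections $h^\alpha_\beta:L_\alpha\to L_\beta$ ($\beta<\alpha<\kappa$) with $h^\beta_\gamma\circ h^\alpha_\beta=h^\alpha_\gamma$. Its limit $L_\infty$ is the set of $(x_\alpha)_{\alpha<\kappa}\in\prod L_\alpha$ with $h^\alpha_\beta(x_\alpha)=x_\beta$, ordered pointwise; the stratified complete lattice determined by it has $x\sqsubseteq_\alpha y$ iff $x_\alpha\leq y_\alpha$ and $x_\beta=y_\beta$ for all $\beta<\alpha$. -}

module Defs where

open import Level using (Level; suc)
open import Relation.Binary.Core using (Rel)
open import Relation.Binary.Bundles using (Poset)
open import Relation.Binary.Structures using (IsPreorder; IsStrictTotalOrder)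
open import Relation.Binary.Definitions using (Irrelevant)
open import Relation.Unary using (Pred; _∈_)
open import Relation.Binary.PropositionalEquality using (_≡_)
open import Induction.WellFounded using (WellFounded)
open import Data.Product using (Σ; ∃; _×_; _,_; proj₁; Σ-syntax; ∃-syntax)

-- A limit ordinal κ, presented as the well-ordered set of ordinals < κ:
-- a strict total well-order (with proof-irrelevant <) that is nonempty
-- (κ ≠ 0) and has no greatest element (κ is not a successor).

record LimitOrdinal (ℓ : Level) : Set (suc ℓ) where
  field
    K                  : Set ℓ
    _<_                : Rel K ℓ
    isStrictTotalOrder : IsStrictTotalOrder _≡_ _<_
    wellFounded        : WellFounded _<_
    <-irrelevant       : Irrelevant _<_
    nonempty           : K
    noMax              : ∀ α → ∃[ β ] (α < β)

  open IsStrictTotalOrder isStrictTotalOrder public using () renaming (trans to <-trans)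

record CompleteLattice (ℓ : Level) : Set (suc ℓ) where
  field
    poset : Poset ℓ ℓ ℓ
  open Poset poset public
  field
    ⋁       : Pred Carrier ℓ → Carrier
    ⋁-upper : ∀ (S : Pred Carrier ℓ) x → x ∈ S → x ≤ ⋁ S
    ⋁-least : ∀ (S : Pred Carrier ℓ) y → (∀ x → x ∈ S → x ≤ y) → ⋁ S ≤ y

module _ {ℓ : Level} (A B : CompleteLattice ℓ) where
  private
    module A = CompleteLattice A
    module B = CompleteLattice B

  Monotone : (A.Carrier → B.Carrier) → Set ℓ
  Monotone f = ∀ x y → x A.≤ y → f x B.≤ f y

module _ {ℓ : Level} (A B : CompleteLattice ℓ) where
  private
    module A = CompleteLattice A
    module B = CompleteLattice B

  IsProjection : (A.Carrier → B.Carrier) → Set ℓ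
  IsProjection h =
    Monotone A B h ×
    Σ[ k ∈ (B.Carrier → A.Carrier) ]
      (Monotone B A k × (∀ x → h (k x) B.≈ x) × (∀ y → k (h y) A.≤ y))

  LocallyCompletelyAdditive : (A.Carrier → B.Carrier) → Set (suc ℓ)
  LocallyCompletelyAdditive h =
    ∀ (Y : Pred A.Carrier ℓ) (x : B.Carrier) →
      (∃[ y ] (y ∈ Y)) → (∀ y → y ∈ Y → h y B.≈ x) → h (A.⋁ Y) B.≈ x

module _ {ℓ : Level} (κ : LimitOrdinal ℓ) where
  open LimitOrdinal κ

  record StratifiedCompleteLattice : Set (suc ℓ) where
    field
      lattice : CompleteLattice ℓ
    open CompleteLattice lattice public
    field
      _⊑[_]_       : Carrier → K → Carrier → Set ℓ
      ⊑-isPreorder : ∀ α → IsPreorder _≈_ (λ x y → x ⊑[ α ] y)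

    _=[_]_ : Carrier → K → Carrier → Set ℓ
    x =[ α ] y = (x ⊑[ α ] y) × (y ⊑[ α ] x)

    IsRestriction : K → Carrier → Carrier → Set ℓ
    IsRestriction α x y = (x =[ α ] y) × (∀ z → x ⊑[ α ] z → y ≤ z)

  record IsModel (S : StratifiedCompleteLattice) : Set (suc ℓ) where
    open StratifiedCompleteLattice S
    field
      A1 : ∀ {α β} x y → α < β → x ⊑[ β ] y → x =[ α ] y
      A2 : ∀ x y → (∀ α → x =[ α ] y) → x ≈ y
      A3 : ∀ x α → ∃[ y ] IsRestriction α x y
      A4 : ∀ α (X : Pred Carrier ℓ) y → (∃[ x ] (x ∈ X)) →
             (∀ x → x ∈ X → x =[ α ] y) → ⋁ X =[ α ] y
      A5 : ∀ α x y x' y' → IsRestriction α x x' → IsRestriction α y y' →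
             x ≤ y → x' ≤ y'
      A6 : ∀ α x y → x ≤ y → (∀ β → β < α → x =[ β ] y) → x ⊑[ α ] y

  record InverseSystem : Set (suc ℓ) where
    field
      L : K → CompleteLattice ℓ
    module L (α : K) = CompleteLattice (L α)
    field
      h          : ∀ {α β} → β < α → L.Carrier α → L.Carrier β
      projection : ∀ {α β} (p : β < α) → IsProjection (L α) (L β) (h p)
      compose    : ∀ {α β γ} (p : β < α) (q : γ < β) (x : L.Carrier α) →
                     L._≈_ γ (h q (h p x)) (h (<-trans q p) x)

    Limit : Set ℓ
    Limit = Σ[ x ∈ ((α : K) → L.Carrier α) ]
              (∀ {α β} (p : β < α) → L._≈_ β (h p (x α)) (x β))

    _≈∞_ : Limit → Limit → Set ℓ
    x ≈∞ y = ∀ α → L._≈_ α (proj₁ x α) (proj₁ y α)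

    _≤∞_ : Limit → Limit → Set ℓ
    x ≤∞ y = ∀ α → L._≤_ α (proj₁ x α) (proj₁ y α)

    _⊑∞[_]_ : Limit → K → Limit → Set ℓ
    x ⊑∞[ α ] y = L._≤_ α (proj₁ x α) (proj₁ y α) ×
                  (∀ β → β < α → L._≈_ β (proj₁ x β) (proj₁ y β))

  AllLocallyCompletelyAdditive : InverseSystem → Set (suc ℓ)
  AllLocallyCompletelyAdditive I =
    ∀ {α β} (p : β < α) → LocallyCompletelyAdditive (L α) (L β) (h p)
    where open InverseSystem I

  record Isomorphism (S : StratifiedCompleteLattice) (I : InverseSystem) : Set (suc ℓ) where
    open StratifiedCompleteLattice S
    open InverseSystem I
    field
      f          : Carrier → Limit
      f-cong     : ∀ x y → x ≈ y → f x ≈∞ f y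
      injective  : ∀ x y → f x ≈∞ f y → x ≈ y
      surjective : ∀ z → ∃[ x ] (f x ≈∞ z)
      ≤-pres     : ∀ x y → x ≤ y → f x ≤∞ f y
      ≤-refl     : ∀ x y → f x ≤∞ f y → x ≤ y
      ⊑-pres     : ∀ α x y → x ⊑[ α ] y → f x ⊑∞[ α ] f y
      ⊑-refl     : ∀ α x y → f x ⊑∞[ α ] f y → x ⊑[ α ] y

module Submission where

-- (⇐, module LimitIsModel) Transport along the isomorphism, so that every
-- element is a thread of coordinates and x =α y just says that the α-th
-- coordinates agree.  The restriction x|α (A3) is the thread that equals x up
-- to stage α and continues above α by the sections k of the projections.  For
-- A4, local complete additivity makes every fibre of a projection have a
-- greatest element; continuing y above α by these fibre tops gives the largest
-- element =α y, which bounds any family of elements =α y.  Both constructions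
-- are instances of one general fact: a thread may be continued above a stage
-- by any coherent family over its α-th coordinate (InverseSystemFacts.Extension).
--
-- (⇒, module ModelIsLimit) In a model, stage α is S itself compared through
-- the restriction x ↦ x|α; all projections are identities with sections x ↦ x|β.
-- A thread (z_α) is glued to the join of its layers z_α|α, which makes
-- x ↦ (x, x, …) an isomorphism onto the limit.

open import Defs
open import Level using (Level)
open import Data.Product using (_×_; Σ-syntax)
open import Data.Product using (Σ; ∃-syntax; _,_; proj₁; proj₂)
open import Data.Empty using (⊥-elim)
open import Relation.Nullary using (¬_)
open import Relation.Binary.PropositionalEquality using (_≡_; refl)
open import Relation.Binary.Definitions using (Tri; tri<; tri≈; tri>)
open import Relation.Binary.Structures using (IsPreorder; IsStrictTotalOrder)
open import Relation.Unary using (Pred)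
import Relation.Binary.Reasoning.PartialOrder as PosetReasoning

module InverseSystemFacts {ℓ : Level} {κ : LimitOrdinal ℓ} (I : InverseSystem κ) where
  open LimitOrdinal κ
  open IsStrictTotalOrder isStrictTotalOrder using (compare; irrefl)
  open InverseSystem I

  k : ∀ {α β} → β < α → L.Carrier β → L.Carrier α
  k p = proj₁ (proj₂ (projection p))

  h-mono : ∀ {α β} (p : β < α) {a b} → L._≤_ α a b → L._≤_ β (h p a) (h p b)
  h-mono p = proj₁ (projection p) _ _

  k-mono : ∀ {α β} (p : β < α) {a b} → L._≤_ β a b → L._≤_ α (k p a) (k p b)
  k-mono p = proj₁ (proj₂ (proj₂ (projection p))) _ _

  h∘k : ∀ {α β} (p : β < α) a → L._≈_ β (h p (k p a)) a
  h∘k p = proj₁ (proj₂ (proj₂ (proj₂ (projection p))))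

  k∘h : ∀ {α β} (p : β < α) b → L._≤_ α (k p (h p b)) b
  k∘h p = proj₂ (proj₂ (proj₂ (proj₂ (projection p))))

  h-cong : ∀ {α β} (p : β < α) {a b} → L._≈_ α a b → L._≈_ β (h p a) (h p b)
  h-cong {α} {β} p a≈b =
    L.antisym β (h-mono p (L.reflexive α a≈b)) (h-mono p (L.reflexive α (L.Eq.sym α a≈b)))

  h-irrelevant : ∀ {α β} (p q : β < α) a → L._≈_ β (h p a) (h q a)
  h-irrelevant {β = β} p q a with <-irrelevant p q
  ... | refl = L.Eq.refl β

  h-compose : ∀ {α β γ} (p : β < α) (q : γ < β) (r : γ < α) a →
              L._≈_ γ (h q (h p a)) (h r a)
  h-compose {γ = γ} p q r a = L.Eq.trans γ (compose p q a) (h-irrelevant _ r a)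

  k-adjoint : ∀ {α β} (p : β < α) {a b} → L._≤_ β a (h p b) → L._≤_ α (k p a) b
  k-adjoint {α} p {a} {b} a≤hb = L.trans α (k-mono p a≤hb) (k∘h p b)

  h∘k-below : ∀ {α δ γ} (p : δ < γ) (q : α < γ) (q' : α < δ) a →
              L._≈_ δ (h p (k q a)) (k q' a)
  h∘k-below {α} {δ} {γ} p q q' a = L.antisym δ upper lower
    where
    open PosetReasoning (L.poset α)
    -- by adjunction, since k p (k q' a) projects back to a
    k-below : L._≤_ γ (k q a) (k p (k q' a))
    k-below = k-adjoint q (begin
      a                         ≈⟨ h∘k q' a ⟨
      h q' (k q' a)             ≈⟨ h-cong q' (h∘k p _) ⟨
      h q' (h p (k p (k q' a))) ≈⟨ h-compose p q' q _ ⟩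
      h q (k p (k q' a))        ∎)
    upper : L._≤_ δ (h p (k q a)) (k q' a)
    upper = L.≤-respʳ-≈ δ (h∘k p _) (h-mono p k-below)
    lower : L._≤_ δ (k q' a) (h p (k q a))
    lower = k-adjoint q' (L.reflexive α (L.Eq.sym α
      (L.Eq.trans α (h-compose p q' q _) (h∘k q a))))

  module Extension (x : Limit) (α : K)
    (g : ∀ γ → α < γ → L.Carrier γ)
    (g-coherent : ∀ {γ δ} (p : δ < γ) (q : α < γ) (q' : α < δ) →
                  L._≈_ δ (h p (g γ q)) (g δ q'))
    (g-over-x : ∀ {γ} (q : α < γ) → L._≈_ α (h q (g γ q)) (proj₁ x α)) where

    value : ∀ γ → Tri (γ < α) (γ ≡ α) (α < γ) → L.Carrier γ
    value γ (tri< _ _ _) = proj₁ x γ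
    value γ (tri≈ _ _ _) = proj₁ x γ
    value γ (tri> _ _ q) = g γ q

    value-coherent : ∀ {γ δ} (p : δ < γ) s t → L._≈_ δ (h p (value γ s)) (value δ t)
    value-coherent p (tri< _ _ _)     (tri< _ _ _)     = proj₂ x p
    value-coherent p (tri< γ<α _ _)   (tri≈ δ≮α _ _)   = ⊥-elim (δ≮α (<-trans p γ<α))
    value-coherent p (tri< γ<α _ _)   (tri> δ≮α _ _)   = ⊥-elim (δ≮α (<-trans p γ<α))
    value-coherent p (tri≈ _ _ _)     (tri< _ _ _)     = proj₂ x p
    value-coherent p (tri≈ _ refl _)  (tri≈ δ≮α _ _)   = ⊥-elim (δ≮α p)
    value-coherent p (tri≈ _ refl γ≯α) (tri> _ _ q')   = ⊥-elim (γ≯α (<-trans q' p))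
    value-coherent {δ = δ} p (tri> _ _ q) (tri< δ<α _ _) =
      L.Eq.trans δ (L.Eq.sym δ (h-compose q δ<α p _))
        (L.Eq.trans δ (h-cong δ<α (g-over-x q)) (proj₂ x δ<α))
    value-coherent p (tri> _ _ q) (tri≈ _ refl _) =
      L.Eq.trans α (h-irrelevant p q _) (g-over-x q)
    value-coherent p (tri> _ _ q) (tri> _ _ q') = g-coherent p q q'

    extended : Limit
    extended = (λ γ → value γ (compare γ α)) ,
               λ {γ} {δ} p → value-coherent p (compare γ α) (compare δ α)

    extended-elim : (P : ∀ γ → L.Carrier γ → Set ℓ) →
      (∀ γ → γ < α → P γ (proj₁ x γ)) → P α (proj₁ x α) →
      (∀ γ (q : α < γ) → P γ (g γ q)) → ∀ γ → P γ (proj₁ extended γ)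
    extended-elim P below at above γ = by-position γ (compare γ α)
      where
      by-position : ∀ γ t → P γ (value γ t)
      by-position γ (tri< γ<α _ _) = below γ γ<α
      by-position γ (tri≈ _ refl _) = at
      by-position γ (tri> _ _ q)    = above γ q

    extended-at : L._≈_ α (proj₁ extended α) (proj₁ x α)
    extended-at =
      extended-elim (λ γ v → ¬ α < γ → L._≈_ γ v (proj₁ x γ))
        (λ γ _ _ → L.Eq.refl γ) (λ _ → L.Eq.refl α) (λ γ q α≮γ → ⊥-elim (α≮γ q))
        α (irrefl refl)

  module FibreTops (lca : AllLocallyCompletelyAdditive κ I) {α : K} (a : L.Carrier α) where

    Fibre : ∀ γ → α < γ → Pred (L.Carrier γ) ℓ
    Fibre γ q b = L._≈_ α (h q b) a

    top : ∀ γ → α < γ → L.Carrier γ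
    top γ q = L.⋁ γ (Fibre γ q)

    -- the fibre contains k q a, so additivity applies to its join
    top-in-fibre : ∀ {γ} (q : α < γ) → L._≈_ α (h q (top γ q)) a
    top-in-fibre {γ} q = lca q (Fibre γ q) a (k q a , h∘k q a) (λ _ b∈Fibre → b∈Fibre)

    top-coherent : ∀ {γ δ} (p : δ < γ) (q : α < γ) (q' : α < δ) →
                   L._≈_ δ (h p (top γ q)) (top δ q')
    top-coherent {γ} {δ} p q q' = L.antisym δ projected-in-fibre section-in-fibre
      where
      projected-in-fibre : L._≤_ δ (h p (top γ q)) (top δ q')
      projected-in-fibre = L.⋁-upper δ (Fibre δ q') _
        (L.Eq.trans α (h-compose p q' q _) (top-in-fibre q))
      section-in-fibre : L._≤_ δ (top δ q') (h p (top γ q))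
      section-in-fibre = L.≤-respˡ-≈ δ (h∘k p _) (h-mono p (L.⋁-upper γ (Fibre γ q) _
        (L.Eq.trans α (L.Eq.sym α (h-compose p q' q _))
          (L.Eq.trans α (h-cong q' (h∘k p _)) (top-in-fibre q')))))

module LimitIsModel {ℓ : Level} {κ : LimitOrdinal ℓ} (S : StratifiedCompleteLattice κ)
  (I : InverseSystem κ) (lca : AllLocallyCompletelyAdditive κ I)
  (iso : Isomorphism κ S I) where
  open LimitOrdinal κ
  open IsStrictTotalOrder isStrictTotalOrder using (compare)
  open InverseSystem I
  open InverseSystemFacts I
  module S = StratifiedCompleteLattice S
  module Iso = Isomorphism iso

  coord : S.Carrier → ∀ γ → L.Carrier γ
  coord x = proj₁ (Iso.f x)

  coord-coherent : ∀ x {α β} (p : β < α) → L._≈_ β (h p (coord x α)) (coord x β)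
  coord-coherent x = proj₂ (Iso.f x)

  preimage : Limit → S.Carrier
  preimage z = proj₁ (Iso.surjective z)

  preimage-coord : ∀ z γ → L._≈_ γ (coord (preimage z) γ) (proj₁ z γ)
  preimage-coord z = proj₂ (Iso.surjective z)

  ≤-preimage : ∀ x z → (∀ γ → L._≤_ γ (coord x γ) (proj₁ z γ)) → x S.≤ preimage z
  ≤-preimage x z x≤z = Iso.≤-refl x (preimage z) λ γ →
    L.≤-respʳ-≈ γ (L.Eq.sym γ (preimage-coord z γ)) (x≤z γ)

  preimage-≤ : ∀ z y → (∀ γ → L._≤_ γ (proj₁ z γ) (coord y γ)) → preimage z S.≤ y
  preimage-≤ z y z≤y = Iso.≤-refl (preimage z) y λ γ →
    L.≤-respˡ-≈ γ (L.Eq.sym γ (preimage-coord z γ)) (z≤y γ)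

  preimage-mono : ∀ z z' → (∀ γ → L._≤_ γ (proj₁ z γ) (proj₁ z' γ)) →
                  preimage z S.≤ preimage z'
  preimage-mono z z' z≤z' = preimage-≤ z (preimage z') λ γ →
    L.≤-respʳ-≈ γ (L.Eq.sym γ (preimage-coord z' γ)) (z≤z' γ)

  ⊑-coord-at : ∀ {α} x y → x S.⊑[ α ] y → L._≤_ α (coord x α) (coord y α)
  ⊑-coord-at {α} x y x⊑y = proj₁ (Iso.⊑-pres α x y x⊑y)

  ⊑-coord-below : ∀ {α} x y → x S.⊑[ α ] y → ∀ β → β < α → L._≈_ β (coord x β) (coord y β)
  ⊑-coord-below {α} x y x⊑y = proj₂ (Iso.⊑-pres α x y x⊑y)

  =-coord-at : ∀ {α} x y → x S.=[ α ] y → L._≈_ α (coord x α) (coord y α)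
  =-coord-at {α} x y (x⊑y , y⊑x) = L.antisym α (⊑-coord-at x y x⊑y) (⊑-coord-at y x y⊑x)

  =-from-coord-at : ∀ {α} x y → L._≈_ α (coord x α) (coord y α) → x S.=[ α ] y
  =-from-coord-at {α} x y xα≈yα = ⊑-from x y xα≈yα , ⊑-from y x (L.Eq.sym α xα≈yα)
    where
    ⊑-from : ∀ x y → L._≈_ α (coord x α) (coord y α) → x S.⊑[ α ] y
    ⊑-from x y xα≈yα = Iso.⊑-refl α x y (L.reflexive α xα≈yα , λ β β<α →
      L.Eq.trans β (L.Eq.sym β (coord-coherent x β<α))
        (L.Eq.trans β (h-cong β<α xα≈yα) (coord-coherent y β<α)))

  module RestrictionThread (x : S.Carrier) (α : K) =
    Extension (Iso.f x) α (λ γ q → k q (coord x α))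
      (λ p q q' → h∘k-below p q q' (coord x α)) (λ q → h∘k q (coord x α))

  restriction : S.Carrier → K → S.Carrier
  restriction x α = preimage (RestrictionThread.extended x α)

  restriction-= : ∀ x α → x S.=[ α ] restriction x α
  restriction-= x α = =-from-coord-at x (restriction x α)
    (L.Eq.sym α (L.Eq.trans α (preimage-coord _ α) (RestrictionThread.extended-at x α)))

  restriction-least : ∀ x α z → x S.⊑[ α ] z → restriction x α S.≤ z
  restriction-least x α z x⊑z = preimage-≤ _ z
    (RestrictionThread.extended-elim x α (λ γ v → L._≤_ γ v (coord z γ))
      (λ γ γ<α → L.reflexive γ (⊑-coord-below x z x⊑z γ γ<α))
      (⊑-coord-at x z x⊑z)
      (λ γ q → k-adjoint q (L.≤-respʳ-≈ α (L.Eq.sym α (coord-coherent z q))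
                                         (⊑-coord-at x z x⊑z))))

  restriction-mono : ∀ x y α → x S.≤ y → restriction x α S.≤ restriction y α
  restriction-mono x y α x≤y = preimage-mono _ _ λ γ → by-position γ (compare γ α)
    where
    by-position : ∀ γ t → L._≤_ γ (RestrictionThread.value x α γ t)
                                   (RestrictionThread.value y α γ t)
    by-position γ (tri< _ _ _) = Iso.≤-pres x y x≤y γ
    by-position γ (tri≈ _ _ _) = Iso.≤-pres x y x≤y γ
    by-position γ (tri> _ _ q) = k-mono q (Iso.≤-pres x y x≤y α)

  module LargestAgreeing (α : K) (y : S.Carrier) where
    open FibreTops lca (coord y α)
    module TopThread = Extension (Iso.f y) α top top-coherent top-in-fibre

    largest : S.Carrier
    largest = preimage TopThread.extended

    largest-coord-at : L._≈_ α (coord largest α) (coord y α)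
    largest-coord-at = L.Eq.trans α (preimage-coord _ α) TopThread.extended-at

    below-largest : ∀ x → x S.=[ α ] y → x S.≤ largest
    below-largest x x=y = ≤-preimage x _
      (TopThread.extended-elim (λ γ v → L._≤_ γ (coord x γ) v)
        (λ γ γ<α → L.reflexive γ (⊑-coord-below x y (proj₁ x=y) γ γ<α))
        (L.reflexive α (=-coord-at x y x=y))
        (λ γ q → L.⋁-upper γ (Fibre γ q) (coord x γ)
                   (L.Eq.trans α (coord-coherent x q) (=-coord-at x y x=y))))

  -- A4: a nonempty family of elements =α y has its join =α y, since the join
  -- lies between one member and the largest element =α y
  join-agreeing : ∀ α (X : Pred S.Carrier ℓ) y → (∃[ x ] X x) →
                  (∀ x → X x → x S.=[ α ] y) → S.⋁ X S.=[ α ] y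
  join-agreeing α X y (x₀ , x₀∈X) X=y = =-from-coord-at (S.⋁ X) y
    (L.antisym α join≤y (L.≤-respˡ-≈ α (=-coord-at x₀ y (X=y x₀ x₀∈X))
                                        (Iso.≤-pres x₀ (S.⋁ X) (S.⋁-upper X x₀ x₀∈X) α)))
    where
    open LargestAgreeing α y
    join≤y : L._≤_ α (coord (S.⋁ X) α) (coord y α)
    join≤y = L.≤-respʳ-≈ α largest-coord-at
      (Iso.≤-pres (S.⋁ X) largest (S.⋁-least X largest λ x x∈X → below-largest x (X=y x x∈X)) α)

  model : IsModel κ S
  model = record
    { A1 = λ {α} {β} x y α<β x⊑y →
             =-from-coord-at x y (⊑-coord-below x y x⊑y α α<β)
    ; A2 = λ x y x=y → Iso.injective x y λ α → =-coord-at x y (x=y α)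
    ; A3 = λ x α → restriction x α , restriction-= x α , restriction-least x α
    ; A4 = join-agreeing
    ; A5 = λ α x y x' y' x'-restricts y'-restricts x≤y →
             S.trans (proj₂ x'-restricts (restriction x α) (proj₁ (restriction-= x α)))
               (S.trans (restriction-mono x y α x≤y)
                 (restriction-least y α y' (proj₁ (proj₁ y'-restricts))))
    ; A6 = λ α x y x≤y x=y → Iso.⊑-refl α x y
             (Iso.≤-pres x y x≤y α , λ β β<α → =-coord-at x y (x=y β β<α))
    }

module ModelIsLimit {ℓ : Level} {κ : LimitOrdinal ℓ} (S : StratifiedCompleteLattice κ)
  (M : IsModel κ S) where
  open LimitOrdinal κ
  open IsStrictTotalOrder isStrictTotalOrder using (compare; irrefl; asym)
  module S = StratifiedCompleteLattice S
  open S using (Carrier; _≤_; _≈_; _⊑[_]_; _=[_]_; ⋁)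
  open IsModel M

  module ⊑ (α : K) = IsPreorder (S.⊑-isPreorder α)

  =-sym : ∀ {α x y} → x =[ α ] y → y =[ α ] x
  =-sym (x⊑y , y⊑x) = y⊑x , x⊑y

  =-trans : ∀ {α x y z} → x =[ α ] y → y =[ α ] z → x =[ α ] z
  =-trans {α} (x⊑y , y⊑x) (y⊑z , z⊑y) = ⊑.trans α x⊑y y⊑z , ⊑.trans α z⊑y y⊑x

  ≈⇒= : ∀ {α x y} → x ≈ y → x =[ α ] y
  ≈⇒= {α} x≈y = ⊑.reflexive α x≈y , ⊑.reflexive α (S.Eq.sym x≈y)

  r : Carrier → K → Carrier
  r x α = proj₁ (A3 x α)

  r-= : ∀ x α → x =[ α ] r x α
  r-= x α = proj₁ (proj₂ (A3 x α))

  r-least : ∀ x α z → x ⊑[ α ] z → r x α ≤ z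
  r-least x α = proj₂ (proj₂ (A3 x α))

  r-≤ : ∀ x α → r x α ≤ x
  r-≤ x α = r-least x α x (⊑.refl α)

  r-mono-⊑ : ∀ {α} x y → x ⊑[ α ] y → r x α ≤ r y α
  r-mono-⊑ {α} x y x⊑y = r-least x α _ (⊑.trans α x⊑y (proj₁ (r-= y α)))

  r-cong : ∀ {α} x y → x =[ α ] y → r x α ≈ r y α
  r-cong x y (x⊑y , y⊑x) = S.antisym (r-mono-⊑ x y x⊑y) (r-mono-⊑ y x y⊑x)

  =-from-r : ∀ {α} x y → r x α ≈ r y α → x =[ α ] y
  =-from-r x y rx≈ry = =-trans (r-= x _) (=-trans (≈⇒= rx≈ry) (=-sym (r-= y _)))

  r-mono : ∀ {α} x y → x ≤ y → r x α ≤ r y α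
  r-mono {α} x y = A5 α x y (r x α) (r y α) (proj₂ (A3 x α)) (proj₂ (A3 y α))

  r-=-below : ∀ x {α β} → β < α → r x α =[ β ] x
  r-=-below x {α} β<α = =-sym (A1 x (r x α) β<α (proj₁ (r-= x α)))

  r-r-below : ∀ x {α β} → ¬ α < β → r (r x α) β ≈ r x β
  r-r-below x {α} {β} α≮β with compare β α
  ... | tri< β<α _ _ = r-cong _ _ (r-=-below x β<α)
  ... | tri≈ _ refl _ = r-cong _ _ (=-sym (r-= x α))
  ... | tri> _ _ α<β = ⊥-elim (α≮β α<β)

  restrictedImage : K → Pred Carrier ℓ → Pred Carrier ℓ
  restrictedImage α Q v = Σ Carrier λ x → Q x × v ≡ r x α

  Stage : K → CompleteLattice ℓ
  Stage α = record
    { poset = record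
      { Carrier = Carrier
      ; _≈_ = λ x y → r x α ≈ r y α
      ; _≤_ = λ x y → r x α ≤ r y α
      ; isPartialOrder = record
        { isPreorder = record
          { isEquivalence = record { refl = S.Eq.refl ; sym = S.Eq.sym ; trans = S.Eq.trans }
          ; reflexive = S.reflexive
          ; trans = S.trans }
        ; antisym = S.antisym } }
    ; ⋁ = λ Q → ⋁ (restrictedImage α Q)
    ; ⋁-upper = λ Q x x∈Q → S.≤-respˡ-≈ (r-r-below x (irrefl refl))
        (r-mono _ _ (S.⋁-upper (restrictedImage α Q) (r x α) (x , x∈Q , refl)))
    ; ⋁-least = λ Q y Q≤y → S.≤-respʳ-≈ (r-r-below y (irrefl refl))
        (r-mono _ _ (S.⋁-least (restrictedImage α Q) (r y α)
          λ { _ (x , x∈Q , refl) → Q≤y x x∈Q }))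
    }

  restrictionSystem : InverseSystem κ
  restrictionSystem = record
    { L = Stage
    ; h = λ _ x → x
    ; projection = λ {α} {β} β<α →
        (λ x y rαx≤rαy → S.≤-respʳ-≈ (r-r-below y (asym β<α))
                           (S.≤-respˡ-≈ (r-r-below x (asym β<α)) (r-mono _ _ rαx≤rαy)))
        , (λ x → r x β)
        , (λ x y rβx≤rβy → r-mono _ _ rβx≤rβy)
        , (λ x → r-r-below x (irrefl refl))
        , (λ y → r-mono _ _ (r-≤ y β))
    ; compose = λ _ _ _ → S.Eq.refl }

  -- local complete additivity is A4 at the lower stage
  restrictionSystem-lca : AllLocallyCompletelyAdditive κ restrictionSystem
  restrictionSystem-lca {α} {β} β<α Y x (y₀ , y₀∈Y) Y≈x =
    r-cong _ _ (A4 β (restrictedImage α Y) x (r y₀ α , y₀ , y₀∈Y , refl)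
      λ { _ (y , y∈Y , refl) → =-trans (r-=-below y β<α) (=-from-r y x (Y≈x y y∈Y)) })


  module Glue (z : K → Carrier) (z-coherent : ∀ {α β} → β < α → r (z α) β ≈ r (z β) β) where

    layer : K → Carrier
    layer γ = r (z γ) γ

    layer-mono : ∀ {β γ} → β < γ → layer β ≤ layer γ
    layer-mono {β} {γ} β<γ = S.≤-respˡ-≈ (z-coherent β<γ)
      (S.≤-respˡ-≈ (r-r-below (z γ) (asym β<γ)) (r-≤ (layer γ) β))

    glued : Carrier
    glued = ⋁ (λ v → Σ K λ γ → v ≡ layer γ)

    glued-= : ∀ α → glued =[ α ] z α
    glued-= α = =-trans (≈⇒= glued≈upper) (=-trans upper=layer (=-sym (r-= (z α) α)))
      where
      upper : Carrier
      upper = ⋁ (λ v → Σ K λ γ → ¬ γ < α × v ≡ layer γ)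

      below-upper : ∀ γ → Tri (γ < α) (γ ≡ α) (α < γ) → layer γ ≤ upper
      below-upper γ (tri< γ<α _ _) = S.trans (layer-mono γ<α) (S.⋁-upper _ _ (α , irrefl refl , refl))
      below-upper γ (tri≈ γ≮α _ _) = S.⋁-upper _ _ (γ , γ≮α , refl)
      below-upper γ (tri> γ≮α _ _) = S.⋁-upper _ _ (γ , γ≮α , refl)

      glued≈upper : glued ≈ upper
      glued≈upper = S.antisym
        (S.⋁-least _ upper λ { _ (γ , refl) → below-upper γ (compare γ α) })
        (S.⋁-least _ glued λ { _ (γ , _ , refl) → S.⋁-upper _ _ (γ , refl) })

      -- every layer at a stage γ ≥ α agrees with layer α at α (A1 and
      -- coherence), hence so does their join (A4)
      upper-layer-= : ∀ γ → ¬ γ < α → Tri (γ < α) (γ ≡ α) (α < γ) → layer γ =[ α ] layer α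
      upper-layer-= γ γ≮α (tri< γ<α _ _) = ⊥-elim (γ≮α γ<α)
      upper-layer-= γ γ≮α (tri≈ _ refl _) = ≈⇒= S.Eq.refl
      upper-layer-= γ γ≮α (tri> _ _ α<γ) =
        =-trans (r-=-below (z γ) α<γ) (=-trans (r-= (z γ) α) (≈⇒= (z-coherent α<γ)))

      upper=layer : upper =[ α ] layer α
      upper=layer = A4 α _ (layer α) (layer α , α , irrefl refl , refl)
        λ { _ (γ , γ≮α , refl) → upper-layer-= γ γ≮α (compare γ α) }

  join-of-restrictions : ∀ x → ⋁ (λ v → Σ K λ γ → v ≡ r x γ) ≈ x
  join-of-restrictions x = A2 _ _ (Glue.glued-= (λ _ → x) (λ _ → S.Eq.refl))

  diagonal : Isomorphism κ S restrictionSystem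
  diagonal = record
    { f          = λ x → (λ _ → x) , λ _ → S.Eq.refl
    ; f-cong     = λ x y x≈y α → r-cong x y (≈⇒= x≈y)
    ; injective  = λ x y rx≈ry → A2 x y λ α → =-from-r x y (rx≈ry α)
    ; surjective = λ { (z , z-coherent) →
        Glue.glued z z-coherent , λ α → r-cong _ _ (Glue.glued-= z z-coherent α) }
    ; ≤-pres     = λ x y x≤y α → r-mono x y x≤y
    ; ≤-refl     = λ x y rx≤ry →
        S.≤-respʳ-≈ (join-of-restrictions y) (S.≤-respˡ-≈ (join-of-restrictions x)
          (S.⋁-least _ _ λ { _ (γ , refl) → S.trans (rx≤ry γ) (S.⋁-upper _ _ (γ , refl)) }))
    ; ⊑-pres     = λ α x y x⊑y → r-mono-⊑ x y x⊑y , λ β β<α → r-cong x y (A1 x y β<α x⊑y)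
    ; ⊑-refl     = λ α x y (rx≤ry , r-below) → ⊑-from-restrictions α x y rx≤ry r-below
    }
    where
    -- x ⊑α x|α ⊑α y|α ⊑α y, the middle step by A6
    ⊑-from-restrictions : ∀ α x y → r x α ≤ r y α → (∀ β → β < α → r x β ≈ r y β) →
                          x ⊑[ α ] y
    ⊑-from-restrictions α x y rx≤ry r-below =
      ⊑.trans α (proj₁ (r-= x α)) (⊑.trans α (A6 α (r x α) (r y α) rx≤ry restrictions-=)
                                              (proj₂ (r-= y α)))
      where
      restrictions-= : ∀ β → β < α → r x α =[ β ] r y α
      restrictions-= β β<α = =-trans (r-=-below x β<α)
        (=-trans (=-from-r x y (r-below β β<α)) (=-sym (r-=-below y β<α)))

corollary16 : ∀ {ℓ : Level} (κ : LimitOrdinal ℓ) (S : StratifiedCompleteLattice κ) →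
    (IsModel κ S →
       Σ[ I ∈ InverseSystem κ ] (AllLocallyCompletelyAdditive κ I × Isomorphism κ S I))
    × (Σ[ I ∈ InverseSystem κ ] (AllLocallyCompletelyAdditive κ I × Isomorphism κ S I) →
       IsModel κ S)
corollary16 κ S =
  (λ M → ModelIsLimit.restrictionSystem S M , ModelIsLimit.restrictionSystem-lca S M
       , ModelIsLimit.diagonal S M)
  , λ { (I , lca , iso) → LimitIsModel.model S I lca iso }
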